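{- If $G$ and $H$ are Left dead ends with $n\cdot G=n\cdot H$ for some integer $n>0$, then $G=H$.
   Context: All games are short partizan combinatorial game forms; $G+H$ is the disjunctive sum and $n\cdot G$ denotes the sum of $n$ copies of $G$. Play is misère (a player unable to move wins). Misère outcome classes are ordered $\mathscr L>\mathscr P>\mathscr R$ and $\mathscr L>\mathscr N>\mathscr R$; $G\geq H$ means that for every game $X$ the misère outcome of $G+X$ is $\geq$ that of $H+X$, and $G=H$ means $G\ge H$ and $H\ge G$. A Left dead end is a game no subposition of which (including itself) has a Left option. -}

module Defs where

open import Data.Nat using (ℕ; zero; suc; _+_)
open import Data.Fin using (Fin; splitAt)
open import Data.Sum using (inj₁; inj₂; [_,_]′)
open import Data.Bool using (Bool; true; false; _∨_; _∧_)
open import Data.Product using (_×_)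
import Relation.Binary.PropositionalEquality
open import Relation.Binary.PropositionalEquality using (_≡_)

data Game : Set where
  mk : (nL : ℕ) → (Fin nL → Game) → (nR : ℕ) → (Fin nR → Game) → Game

𝟘 : Game
𝟘 = mk 0 (λ ()) 0 (λ ())

infixl 6 _⊕_
_⊕_ : Game → Game → Game
G@(mk nL gL nR gR) ⊕ H@(mk mL hL mR hR) =
  mk (nL + mL) (λ k → [ (λ i → gL i ⊕ H) , (λ j → G ⊕ hL j) ]′ (splitAt nL k))
     (nR + mR) (λ k → [ (λ i → gR i ⊕ H) , (λ j → G ⊕ hR j) ]′ (splitAt nR k))

infixr 7 _·_
_·_ : ℕ → Game → Game
zero · G = 𝟘
suc n · G = G ⊕ (n · G)

anyFin : (n : ℕ) → (Fin n → Bool) → Bool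
anyFin zero f = false
anyFin (suc n) f = f Fin.zero ∨ anyFin n (λ i → f (Fin.suc i))

allFin : (n : ℕ) → (Fin n → Bool) → Bool
allFin zero f = true
allFin (suc n) f = f Fin.zero ∧ allFin n (λ i → f (Fin.suc i))

-- Misère play (a player unable to move wins).
-- leftWinsFirst G  : Left wins G moving first.
-- leftWinsSecond G : Left wins G when Right moves first.
mutual
  leftWinsFirst : Game → Bool
  leftWinsFirst (mk zero gL nR gR) = true
  leftWinsFirst (mk (suc k) gL nR gR) = anyFin (suc k) (λ i → leftWinsSecond (gL i))

  leftWinsSecond : Game → Bool
  leftWinsSecond (mk nL gL zero gR) = false
  leftWinsSecond (mk nL gL (suc k) gR) = allFin (suc k) (λ j → leftWinsFirst (gR j))

data Outcome : Set where
  𝓛 𝓝 𝓟 𝓡 : Outcome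

outcomeOf : Bool → Bool → Outcome
outcomeOf true  true  = 𝓛
outcomeOf true  false = 𝓝
outcomeOf false true  = 𝓟
outcomeOf false false = 𝓡

outcome : Game → Outcome
outcome G = outcomeOf (leftWinsFirst G) (leftWinsSecond G)

data _≥ₒ_ : Outcome → Outcome → Set where
  refl≥ : ∀ {o} → o ≥ₒ o
  𝓛≥𝓝 : 𝓛 ≥ₒ 𝓝
  𝓛≥𝓟 : 𝓛 ≥ₒ 𝓟
  𝓛≥𝓡 : 𝓛 ≥ₒ 𝓡
  𝓝≥𝓡 : 𝓝 ≥ₒ 𝓡
  𝓟≥𝓡 : 𝓟 ≥ₒ 𝓡

_≥ₘ_ : Game → Game → Set
G ≥ₘ H = ∀ (X : Game) → outcome (G ⊕ X) ≥ₒ outcome (H ⊕ X)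

_≡ₘ_ : Game → Game → Set
G ≡ₘ H = (G ≥ₘ H) × (H ≥ₘ G)

data LeftDeadEnd : Game → Set where
  lde : ∀ {gL : Fin 0 → Game} {nR} {gR : Fin nR → Game} →
        (∀ j → LeftDeadEnd (gR j)) → LeftDeadEnd (mk 0 gL nR gR)

private
  sanity : outcome 𝟘 ≡ 𝓝
  sanity = Relation.Binary.PropositionalEquality.refl

{-# OPTIONS --safe #-}
-- Left has no move in a Left dead end, so misère comparison of dead ends only sees Right's moves:
-- A ≥ B exactly when B ≼ A, i.e. when A being a Right end forces B to be one and every Right option
-- of A lies above some Right option of B.  When B ⋠ A, a distinguishing game is built recursively,
-- using Left integers exactly as long as a run of Right moves.
--
-- Modulo ≼ the sum is a commutative monoid, and a cancellative one: the least number of Right moves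
-- needed to reach a Right end is superadditive over ⊕ and monotone under ≼, which rules out
-- B ⊕ K ≼ K unless B is a Right end.  If (1+m)·G ≋ (1+m)·H, match a Right option H^R ⊕ m·H of
-- (1+m)·H with some G^R ⊕ m·G and back with some H^R′ ⊕ m·H.  Cancelling m·H gives H^R′ ≼ H^R, and
-- as the Right options of H form a finite preorder, descending in it reaches a case where
-- H^R ⊕ m·H ≋ G^R ⊕ m·G.  Multiplying by 1+m and cancelling yields (1+m)·H^R ≋ (1+m)·G^R, so
-- induction applies.
module Submission where

open import Defs
open import Algebra.Bundles using (CommutativeMonoid)
open import Algebra.Structures using (IsCommutativeMonoid)
open import Data.Bool using (Bool; true; false; T)
open import Data.Bool.Properties using (T-∨; T-∧)
open import Data.Empty using (⊥-elim)
open import Data.Fin using (Fin; zero; suc; splitAt; _↑ˡ_; _↑ʳ_)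
open import Data.Fin.Induction using (spo-wellFounded)
open import Data.Fin.Properties using (splitAt-↑ˡ; splitAt-↑ʳ; all?; any?; ¬∀⟶∃¬)
open import Data.Nat using (ℕ; zero; suc; _+_; _*_; _≤_; _<_; z≤n; s≤s; _≟_)
open import Data.Nat.Properties
  using ( m+n≡0⇒m≡0; m+n≡0⇒n≡0; *-comm; ≤-refl; ≤-trans; ≤-reflexive; ≤-total
        ; +-monoˡ-≤; +-monoʳ-≤; +-suc; +-cancelʳ-≤; n≤0⇒n≡0)
open import Data.Product using (_×_; _,_; ∃; ∃₂; proj₁; proj₂)
open import Data.Sum using (_⊎_; inj₁; inj₂; [_,_]′)
import Data.Sum as Sum
open import Data.Unit using (tt)
open import Data.Vec.Functional using (_∷_)
open import Function using (flip; _∘_; case_of_)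
open import Function.Bundles using (_⇔_; mk⇔; Equivalence)
open import Induction.WellFounded using (WellFounded; Acc; acc)
open import Relation.Binary.Bundles using (Preorder)
open import Relation.Binary.Core using (Rel)
open import Relation.Binary.Definitions using (Decidable)
open import Relation.Binary.PropositionalEquality
  using (_≡_; refl; sym; cong; cong₂; subst; resp₂; isEquivalence)
import Relation.Binary.Reasoning.Preorder as PreorderReasoning
open import Relation.Binary.Structures using (IsPreorder)
open import Relation.Nullary using (¬_; yes; no)
open import Relation.Nullary.Decidable using (_×-dec_; _→-dec_; decidable-stable)
import Relation.Nullary.Decidable as Dec

nRight : Game → ℕ
nRight (mk _ _ n _) = n

right : (G : Game) → Fin (nRight G) → Game
right (mk _ _ _ g) = g

RightEnd : Game → Set
RightEnd G = nRight G ≡ 0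

RightEnd-⊕ : ∀ A B → RightEnd A → RightEnd B → RightEnd (A ⊕ B)
RightEnd-⊕ (mk _ _ _ _) (mk _ _ _ _) a b = cong₂ _+_ a b

RightEnd-⊕⁻ : ∀ A B → RightEnd (A ⊕ B) → RightEnd A × RightEnd B
RightEnd-⊕⁻ (mk _ _ n _) (mk _ _ _ _) e = m+n≡0⇒m≡0 n e , m+n≡0⇒n≡0 n e

infix 4 _∈ᴿ_
data _∈ᴿ_ : Game → Game → Set where
  right∈ᴿ : ∀ {A} i → right A i ∈ᴿ A

all-∈ᴿ : ∀ (P : Game → Set) {G Y} → (∀ k → P (right G k)) → Y ∈ᴿ G → P Y
all-∈ᴿ P ps (right∈ᴿ k) = ps k

∈ᴿ-⊕ˡ : ∀ {Y} A B → Y ∈ᴿ A → Y ⊕ B ∈ᴿ A ⊕ B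
∈ᴿ-⊕ˡ (mk _ _ n _) (mk _ _ m _) (right∈ᴿ i) =
  subst (_∈ᴿ _) (cong [ _ , _ ]′ (splitAt-↑ˡ n i m)) (right∈ᴿ (i ↑ˡ m))

∈ᴿ-⊕ʳ : ∀ {Y} A B → Y ∈ᴿ B → A ⊕ Y ∈ᴿ A ⊕ B
∈ᴿ-⊕ʳ (mk _ _ n _) (mk _ _ m _) (right∈ᴿ j) =
  subst (_∈ᴿ _) (cong [ _ , _ ]′ (splitAt-↑ʳ n m j)) (right∈ᴿ (n ↑ʳ j))

right-⊕-elim : (P : Game → Set) → ∀ A B →
  (∀ i → P (right A i ⊕ B)) → (∀ j → P (A ⊕ right B j)) → ∀ k → P (right (A ⊕ B) k)
right-⊕-elim P (mk _ _ n _) (mk _ _ _ _) l r k with splitAt n k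
... | inj₁ i = l i
... | inj₂ j = r j

-- The Right-option order

infix 4 _≼_ _≼ᴿ_ _≋_
data _≼_ : Game → Game → Set

_≼ᴿ_ : Game → Game → Set
B ≼ᴿ Y = ∃ λ j → right B j ≼ Y

data _≼_ where
  ≼-intro : ∀ {B A} → (RightEnd A → RightEnd B) → (∀ i → B ≼ᴿ right A i) → B ≼ A

_≋_ : Game → Game → Set
A ≋ B = A ≼ B × B ≼ A

≼-RightEnd : ∀ {B A} → B ≼ A → RightEnd A → RightEnd B
≼-RightEnd (≼-intro end _) = end

≼⇒≼ᴿ : ∀ {B A Y} → B ≼ A → Y ∈ᴿ A → B ≼ᴿ Y
≼⇒≼ᴿ (≼-intro _ opts) (right∈ᴿ i) = opts i

≼ᴿ-intro : ∀ {B Y Z} → Z ∈ᴿ B → Z ≼ Y → B ≼ᴿ Y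
≼ᴿ-intro (right∈ᴿ j) p = j , p

≼-refl : ∀ {A} → A ≼ A
≼-refl {mk _ _ _ g} = ≼-intro (λ e → e) (λ i → i , ≼-refl {g i})

≼-trans : ∀ {A B C} → A ≼ B → B ≼ C → A ≼ C
≼-trans (≼-intro endᴬ optsᴬ) (≼-intro endᴮ optsᴮ) =
  ≼-intro (λ e → endᴬ (endᴮ e)) λ k →
    let (j , q) = optsᴮ k ; (i , p) = optsᴬ j in i , ≼-trans p q

_≼?_ : Decidable _≼_
B ≼? A@(mk _ _ _ f) =
  Dec.map′ (λ (end , opts) → ≼-intro end opts) (λ { (≼-intro end opts) → end , opts })
    ((nRight A ≟ 0 →-dec nRight B ≟ 0) ×-dec all? (λ i → any? (λ j → right B j ≼? f i)))

≼-isPreorder : IsPreorder _≋_ _≼_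
≼-isPreorder = record
  { isEquivalence = record
    { refl = ≼-refl , ≼-refl
    ; sym = λ (p , q) → q , p
    ; trans = λ (p , q) (p′ , q′) → ≼-trans p p′ , ≼-trans q′ q
    }
  ; reflexive = proj₁
  ; trans = ≼-trans
  }

≼-preorder : Preorder _ _ _
≼-preorder = record { isPreorder = ≼-isPreorder }

module ≼-Reasoning = PreorderReasoning ≼-preorder

-- Sums modulo ≋

⊕-≼-intro : ∀ {C} A B → (RightEnd A → RightEnd B → RightEnd C) →
  (∀ i → C ≼ᴿ right A i ⊕ B) → (∀ j → C ≼ᴿ A ⊕ right B j) → C ≼ A ⊕ B
⊕-≼-intro {C} A B end l r =
  ≼-intro (λ e → let (a , b) = RightEnd-⊕⁻ A B e in end a b) (right-⊕-elim (C ≼ᴿ_) A B l r)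

⊕-comm-≼ : ∀ A B → B ⊕ A ≼ A ⊕ B
⊕-comm-≼ A@(mk _ _ _ f) B@(mk _ _ _ g) = ⊕-≼-intro A B (flip (RightEnd-⊕ B A))
  (λ i → ≼ᴿ-intro (∈ᴿ-⊕ʳ B A (right∈ᴿ i)) (⊕-comm-≼ (f i) B))
  (λ j → ≼ᴿ-intro (∈ᴿ-⊕ˡ B A (right∈ᴿ j)) (⊕-comm-≼ A (g j)))

⊕-comm-≋ : ∀ A B → A ⊕ B ≋ B ⊕ A
⊕-comm-≋ A B = ⊕-comm-≼ B A , ⊕-comm-≼ A B

⊕-assoc-≼ : ∀ A B C → A ⊕ (B ⊕ C) ≼ (A ⊕ B) ⊕ C
⊕-assoc-≼ A@(mk _ _ _ f) B@(mk _ _ _ g) C@(mk _ _ _ h) =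
  ⊕-≼-intro (A ⊕ B) C
    (λ ab c → let (a , b) = RightEnd-⊕⁻ A B ab in RightEnd-⊕ A (B ⊕ C) a (RightEnd-⊕ B C b c))
    (right-⊕-elim (λ X → A ⊕ (B ⊕ C) ≼ᴿ X ⊕ C) A B
      (λ i → ≼ᴿ-intro (∈ᴿ-⊕ˡ A (B ⊕ C) (right∈ᴿ i)) (⊕-assoc-≼ (f i) B C))
      (λ j → ≼ᴿ-intro (∈ᴿ-⊕ʳ A (B ⊕ C) (∈ᴿ-⊕ˡ B C (right∈ᴿ j))) (⊕-assoc-≼ A (g j) C)))
    (λ k → ≼ᴿ-intro (∈ᴿ-⊕ʳ A (B ⊕ C) (∈ᴿ-⊕ʳ B C (right∈ᴿ k))) (⊕-assoc-≼ A B (h k)))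

⊕-assoc-≋ : ∀ A B C → (A ⊕ B) ⊕ C ≋ A ⊕ (B ⊕ C)
⊕-assoc-≋ A B C = assocʳ , ⊕-assoc-≼ A B C
  where
  open ≼-Reasoning
  assocʳ : (A ⊕ B) ⊕ C ≼ A ⊕ (B ⊕ C)
  assocʳ = begin
    (A ⊕ B) ⊕ C  ≈⟨ ⊕-comm-≋ (A ⊕ B) C ⟩
    C ⊕ (A ⊕ B)  ≲⟨ ⊕-assoc-≼ C A B ⟩
    (C ⊕ A) ⊕ B  ≈⟨ ⊕-comm-≋ (C ⊕ A) B ⟩
    B ⊕ (C ⊕ A)  ≲⟨ ⊕-assoc-≼ B C A ⟩
    (B ⊕ C) ⊕ A  ≈⟨ ⊕-comm-≋ (B ⊕ C) A ⟩
    A ⊕ (B ⊕ C)  ∎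

⊕-identityˡ-≋ : ∀ A → 𝟘 ⊕ A ≋ A
⊕-identityˡ-≋ (mk _ _ _ g) =
  ≼-intro (λ e → e) (λ i → i , proj₁ (⊕-identityˡ-≋ (g i))) ,
  ≼-intro (λ e → e) (λ i → i , proj₂ (⊕-identityˡ-≋ (g i)))

⊕-monoˡ-≼ : ∀ {B A} K → B ≼ A → B ⊕ K ≼ A ⊕ K
⊕-monoˡ-≼ {B} {A@(mk _ _ _ f)} K@(mk _ _ _ h) p@(≼-intro end opts) =
  ⊕-≼-intro A K (λ a k → RightEnd-⊕ B K (end a) k)
    (λ i → let (j , q) = opts i in ≼ᴿ-intro (∈ᴿ-⊕ˡ B K (right∈ᴿ j)) (⊕-monoˡ-≼ K q))
    (λ x → ≼ᴿ-intro (∈ᴿ-⊕ʳ B K (right∈ᴿ x)) (⊕-monoˡ-≼ (h x) p))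

⊕-monoʳ-≼ : ∀ K {B A} → B ≼ A → K ⊕ B ≼ K ⊕ A
⊕-monoʳ-≼ K {B} {A} p = begin
  K ⊕ B  ≈⟨ ⊕-comm-≋ K B ⟩
  B ⊕ K  ≲⟨ ⊕-monoˡ-≼ K p ⟩
  A ⊕ K  ≈⟨ ⊕-comm-≋ A K ⟩
  K ⊕ A  ∎
  where open ≼-Reasoning

⊕-mono-≼ : ∀ {B A D C} → B ≼ A → D ≼ C → B ⊕ D ≼ A ⊕ C
⊕-mono-≼ {A = A} {D} p q = ≼-trans (⊕-monoˡ-≼ D p) (⊕-monoʳ-≼ A q)

⊕-𝟘-isCommutativeMonoid : IsCommutativeMonoid _≋_ _⊕_ 𝟘
⊕-𝟘-isCommutativeMonoid = record
  { isMonoid = record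
    { isSemigroup = record
      { isMagma = record
        { isEquivalence = IsPreorder.isEquivalence ≼-isPreorder
        ; ∙-cong = λ (p , q) (p′ , q′) → ⊕-mono-≼ p p′ , ⊕-mono-≼ q q′
        }
      ; assoc = ⊕-assoc-≋
      }
    ; identity = ⊕-identityˡ-≋ , λ A → begin-equality
        A ⊕ 𝟘  ≈⟨ ⊕-comm-≋ A 𝟘 ⟩
        𝟘 ⊕ A  ≈⟨ ⊕-identityˡ-≋ A ⟩
        A      ∎
    }
  ; comm = ⊕-comm-≋
  }
  where open ≼-Reasoning

⊕-𝟘-commutativeMonoid : CommutativeMonoid _ _
⊕-𝟘-commutativeMonoid = record { isCommutativeMonoid = ⊕-𝟘-isCommutativeMonoid }

open CommutativeMonoid ⊕-𝟘-commutativeMonoid using (∙-congˡ; commutativeSemigroup)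
open import Algebra.Properties.CommutativeSemigroup commutativeSemigroup using (x∙yz≈y∙xz)
open import Algebra.Properties.CommutativeMonoid.Mult ⊕-𝟘-commutativeMonoid
  using (×-distrib-+; ×-assocˡ) renaming (_×_ to _×ᵍ_)

·≡×ᵍ : ∀ n G → n · G ≡ n ×ᵍ G
·≡×ᵍ zero    G = refl
·≡×ᵍ (suc n) G = cong (G ⊕_) (·≡×ᵍ n G)

·-distrib-⊕ : ∀ n A B → n · (A ⊕ B) ≋ n · A ⊕ n · B
·-distrib-⊕ n A B rewrite ·≡×ᵍ n (A ⊕ B) | ·≡×ᵍ n A | ·≡×ᵍ n B = ×-distrib-+ A B n

·-comm : ∀ m n G → m · (n · G) ≋ n · (m · G)
·-comm m n G rewrite ·≡×ᵍ n G | ·≡×ᵍ m G | ·≡×ᵍ m (n ×ᵍ G) | ·≡×ᵍ n (m ×ᵍ G) = begin-equality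
  m ×ᵍ (n ×ᵍ G)  ≈⟨ ×-assocˡ G m n ⟩
  (m * n) ×ᵍ G   ≡⟨ cong (_×ᵍ G) (*-comm m n) ⟩
  (n * m) ×ᵍ G   ≈⟨ ×-assocˡ G n m ⟨
  n ×ᵍ (m ×ᵍ G)  ∎
  where open ≼-Reasoning

·-mono-≼ : ∀ n {B A} → B ≼ A → n · B ≼ n · A
·-mono-≼ zero    p = ≼-refl
·-mono-≼ (suc n) p = ⊕-mono-≼ p (·-mono-≼ n p)

RightEnd-· : ∀ n G → RightEnd G → RightEnd (n · G)
RightEnd-· zero    G _ = refl
RightEnd-· (suc n) G e = RightEnd-⊕ G (n · G) e (RightEnd-· n G e)

-- Cancellation

argmin : ∀ r (f : Fin (suc r) → ℕ) → ∃ λ i → ∀ j → f i ≤ f j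
argmin zero    f = zero , λ { zero → ≤-refl }
argmin (suc r) f with argmin r (f ∘ suc)
... | i , min with ≤-total (f zero) (f (suc i))
...   | inj₁ z≤i = zero  , λ { zero → ≤-refl ; (suc j) → ≤-trans z≤i (min j) }
...   | inj₂ i≤z = suc i , λ { zero → i≤z ; (suc j) → min j }

endDistance : Game → ℕ
endDistance (mk _ _ zero    _) = 0
endDistance (mk _ _ (suc r) g) = suc (endDistance (g (proj₁ (argmin r (endDistance ∘ g)))))

endDistance-right : ∀ G i → endDistance G ≤ suc (endDistance (right G i))
endDistance-right (mk _ _ (suc r) g) i = s≤s (proj₂ (argmin r (endDistance ∘ g)) i)

endDistance-attained : ∀ G → RightEnd G ⊎ ∃ λ i → endDistance G ≡ suc (endDistance (right G i))
endDistance-attained (mk _ _ zero    _) = inj₁ refl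
endDistance-attained (mk _ _ (suc r) g) = inj₂ (proj₁ (argmin r (endDistance ∘ g)) , refl)

RightEnd⇒endDistance≡0 : ∀ G → RightEnd G → endDistance G ≡ 0
RightEnd⇒endDistance≡0 (mk _ _ zero _) _ = refl

endDistance≡0⇒RightEnd : ∀ G → endDistance G ≡ 0 → RightEnd G
endDistance≡0⇒RightEnd (mk _ _ zero _) _ = refl

≼⇒endDistance-≤ : ∀ {B A} → B ≼ A → endDistance B ≤ endDistance A
≼⇒endDistance-≤ {B} {A} (≼-intro end opts) with endDistance-attained A
... | inj₁ a       = ≤-trans (≤-reflexive (RightEnd⇒endDistance≡0 B (end a))) z≤n
... | inj₂ (i , e) = let (j , p) = opts i in
  ≤-trans (endDistance-right B j) (≤-trans (s≤s (≼⇒endDistance-≤ p)) (≤-reflexive (sym e)))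

endDistance-⊕ : ∀ A B → endDistance A + endDistance B ≤ endDistance (A ⊕ B)
endDistance-⊕-right : ∀ A B k → endDistance A + endDistance B ≤ suc (endDistance (right (A ⊕ B) k))

endDistance-⊕ A B with endDistance-attained (A ⊕ B)
... | inj₁ end = let (a , b) = RightEnd-⊕⁻ A B end in
  ≤-trans (≤-reflexive (cong₂ _+_ (RightEnd⇒endDistance≡0 A a) (RightEnd⇒endDistance≡0 B b))) z≤n
... | inj₂ (k , e) = subst (endDistance A + endDistance B ≤_) (sym e) (endDistance-⊕-right A B k)

endDistance-⊕-right A@(mk _ _ _ f) B@(mk _ _ _ g) =
  right-⊕-elim (λ X → endDistance A + endDistance B ≤ suc (endDistance X)) A B
    (λ i → ≤-trans (+-monoˡ-≤ _ (endDistance-right A i)) (s≤s (endDistance-⊕ (f i) B)))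
    (λ j → ≤-trans (+-monoʳ-≤ (endDistance A) (endDistance-right B j))
             (≤-trans (≤-reflexive (+-suc _ _)) (s≤s (endDistance-⊕ A (g j)))))

≼-⊕-RightEnd : ∀ B K → B ⊕ K ≼ K → RightEnd B
≼-⊕-RightEnd B K p = endDistance≡0⇒RightEnd B (n≤0⇒n≡0 (+-cancelʳ-≤ (endDistance K) (endDistance B) 0
  (≤-trans (endDistance-⊕ B K) (≼⇒endDistance-≤ p))))

RightEnd⇒≼𝟘 : ∀ {A} → RightEnd A → A ≼ 𝟘
RightEnd⇒≼𝟘 a = ≼-intro (λ _ → a) (λ ())

⊕-≼ᴿ-chase : ∀ X B K → B ⊕ K ≼ᴿ X ⊕ K → ∃₂ λ j K′ → right B j ⊕ K′ ≼ X ⊕ K′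
⊕-≼ᴿ-chase X B K@(mk _ _ _ h) (k , p) =
  right-⊕-elim (λ Y → Y ≼ X ⊕ K → ∃₂ λ j K′ → right B j ⊕ K′ ≼ X ⊕ K′) B K
    (λ j q → j , K , q)
    (λ x q → ⊕-≼ᴿ-chase X B (h x) (≼⇒≼ᴿ q (∈ᴿ-⊕ʳ X K (right∈ᴿ x))))
    k p

⊕-cancelʳ-≼ : ∀ B A K → B ⊕ K ≼ A ⊕ K → B ≼ A
⊕-cancelʳ-≼ B A@(mk _ _ _ f) K p = ≼-intro
  (λ a → ≼-⊕-RightEnd B K (≼-trans p (≼-trans (⊕-monoˡ-≼ K (RightEnd⇒≼𝟘 a)) (proj₁ (⊕-identityˡ-≋ K)))))
  (λ i → let (j , K′ , q) = ⊕-≼ᴿ-chase (f i) B K (≼⇒≼ᴿ p (∈ᴿ-⊕ˡ A K (right∈ᴿ i)))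
         in j , ⊕-cancelʳ-≼ (right B j) (f i) K′ q)

·-⊕-cancelʳ-≼ : ∀ k m {A B G H} → B ⊕ m · H ≼ A ⊕ m · G → k · G ≼ k · H → k · B ≼ k · A
·-⊕-cancelʳ-≼ k m {A} {B} {G} {H} p q = ⊕-cancelʳ-≼ (k · B) (k · A) (m · (k · G)) (begin
  k · B ⊕ m · (k · G)  ≲⟨ ⊕-monoʳ-≼ (k · B) (·-mono-≼ m q) ⟩
  k · B ⊕ m · (k · H)  ≈⟨ ∙-congˡ (·-comm m k H) ⟩
  k · B ⊕ k · (m · H)  ≈⟨ ·-distrib-⊕ k B (m · H) ⟨
  k · (B ⊕ m · H)      ≲⟨ ·-mono-≼ k p ⟩
  k · (A ⊕ m · G)      ≈⟨ ·-distrib-⊕ k A (m · G) ⟩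
  k · A ⊕ k · (m · G)  ≈⟨ ∙-congˡ (·-comm k m G) ⟩
  k · A ⊕ m · (k · G)  ∎)
  where open ≼-Reasoning

-- Cancelling multiples

right-suc· : ∀ m H k → ∃ λ j → right H j ⊕ m · H ≼ right (suc m · H) k
right-suc· zero    H = right-⊕-elim (λ Y → ∃ λ j → right H j ⊕ 𝟘 ≼ Y) H 𝟘 (λ j → j , ≼-refl) (λ ())
right-suc· (suc m) H = right-⊕-elim (λ Y → ∃ λ j → right H j ⊕ suc m · H ≼ Y) H (suc m · H)
  (λ j → j , ≼-refl)
  (λ k → let (j , p) = right-suc· m H k in j , (begin
    right H j ⊕ (H ⊕ m · H)  ≈⟨ x∙yz≈y∙xz (right H j) H (m · H) ⟩
    H ⊕ (right H j ⊕ m · H)  ≲⟨ ⊕-monoʳ-≼ H p ⟩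
    H ⊕ right (suc m · H) k  ∎))
  where open ≼-Reasoning

suc·-≼⇒right : ∀ m {G H} → suc m · H ≼ suc m · G →
  ∀ i → ∃ λ j → right H j ⊕ m · H ≼ right G i ⊕ m · G
suc·-≼⇒right m {G} {H} p i =
  let (k , q) = ≼⇒≼ᴿ p (∈ᴿ-⊕ˡ G (m · G) (right∈ᴿ i)) ; (j , r) = right-suc· m H k in j , ≼-trans r q

StrictlyBelow : ∀ {n} → (Fin n → Game) → Rel (Fin n) _
StrictlyBelow f a b = f a ≼ f b × ¬ f b ≼ f a

StrictlyBelow-wellFounded : ∀ {n} (f : Fin n → Game) → WellFounded (StrictlyBelow f)
StrictlyBelow-wellFounded f = spo-wellFounded {_≈_ = _≡_} record
  { isEquivalence = isEquivalence
  ; irrefl = λ { refl (p , ¬p) → ¬p p }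
  ; trans = λ (p , ¬q) (r , ¬s) → ≼-trans p r , λ t → ¬s (≼-trans t p)
  ; <-resp-≈ = resp₂ (StrictlyBelow f)
  }

·-cancel-≼ : ∀ m {G H} → suc m · G ≋ suc m · H → G ≼ H
·-cancel-≼ m {G} {H@(mk _ _ _ h)} (p , q) = ≼-intro
  (λ e → proj₁ (RightEnd-⊕⁻ G (m · G) (≼-RightEnd p (RightEnd-· (suc m) H e))))
  (λ i → below i (StrictlyBelow-wellFounded h i))
  where
  below : ∀ i → Acc (StrictlyBelow h) i → G ≼ᴿ h i
  below i (acc rec) =
    let (j , Gj≼hi) = suc·-≼⇒right m p i
        (i′ , hi′≼Gj) = suc·-≼⇒right m q j
        hi′≼hi = ⊕-cancelʳ-≼ (h i′) (h i) (m · H) (≼-trans hi′≼Gj Gj≼hi)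
    in case h i ≼? h i′ of λ where
      (yes hi≼hi′) → j , ·-cancel-≼ m
        ( ·-⊕-cancelʳ-≼ (suc m) m Gj≼hi q
        , ·-⊕-cancelʳ-≼ (suc m) m (≼-trans (⊕-monoˡ-≼ (m · H) hi≼hi′) hi′≼Gj) p)
      (no hi⋠hi′) → let (j′ , r) = below i′ (rec (hi′≼hi , hi⋠hi′)) in j′ , ≼-trans r hi′≼hi

·-cancel-≋ : ∀ m {G H} → suc m · G ≋ suc m · H → G ≋ H
·-cancel-≋ m (p , q) = ·-cancel-≼ m (p , q) , ·-cancel-≼ m (q , p)

-- Misère play on Left dead ends

nLeft : Game → ℕ
nLeft (mk n _ _ _) = n

left : (G : Game) → Fin (nLeft G) → Game
left (mk _ g _ _) = g

LeftDeadEnd-⊕ : ∀ {A B} → LeftDeadEnd A → LeftDeadEnd B → LeftDeadEnd (A ⊕ B)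
LeftDeadEnd-⊕ {A} {B} dA@(lde dAʳ) dB@(lde dBʳ) =
  lde (right-⊕-elim LeftDeadEnd A B (λ i → LeftDeadEnd-⊕ (dAʳ i) dB) (λ j → LeftDeadEnd-⊕ dA (dBʳ j)))

LeftDeadEnd-· : ∀ n {G} → LeftDeadEnd G → LeftDeadEnd (n · G)
LeftDeadEnd-· zero    _  = lde (λ ())
LeftDeadEnd-· (suc n) dG = LeftDeadEnd-⊕ dG (LeftDeadEnd-· n dG)

anyFin⁺ : ∀ n f i → T (f i) → T (anyFin n f)
anyFin⁺ (suc n) f zero    t = Equivalence.from T-∨ (inj₁ t)
anyFin⁺ (suc n) f (suc i) t = Equivalence.from T-∨ (inj₂ (anyFin⁺ n (f ∘ suc) i t))

anyFin⁻ : ∀ n f → T (anyFin n f) → ∃ λ i → T (f i)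
anyFin⁻ (suc n) f t =
  [ (λ t₀ → zero , t₀) , (λ t′ → let (i , tᵢ) = anyFin⁻ n (f ∘ suc) t′ in suc i , tᵢ) ]′
    (Equivalence.to T-∨ t)

allFin⁺ : ∀ n f → (∀ i → T (f i)) → T (allFin n f)
allFin⁺ zero    f t = tt
allFin⁺ (suc n) f t = Equivalence.from T-∧ (t zero , allFin⁺ n (f ∘ suc) (t ∘ suc))

allFin⁻ : ∀ n f → T (allFin n f) → ∀ i → T (f i)
allFin⁻ (suc n) f t zero    = proj₁ (Equivalence.to T-∧ t)
allFin⁻ (suc n) f t (suc i) = allFin⁻ n (f ∘ suc) (proj₂ (Equivalence.to T-∧ t)) i

leftWinsSecond⁺ : ∀ G → ¬ RightEnd G → (∀ k → T (leftWinsFirst (right G k))) → T (leftWinsSecond G)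
leftWinsSecond⁺ (mk _ _ zero    _) ¬end _ = ⊥-elim (¬end refl)
leftWinsSecond⁺ (mk _ _ (suc r) _) _    w = allFin⁺ (suc r) _ w

leftWinsSecond⁻ : ∀ G → T (leftWinsSecond G) → ¬ RightEnd G × (∀ k → T (leftWinsFirst (right G k)))
leftWinsSecond⁻ (mk _ _ (suc r) _) w = (λ ()) , allFin⁻ (suc r) _ w

leftWinsFirst-LeftDeadEnd-⊕ : ∀ {D} X → LeftDeadEnd D →
  T (leftWinsFirst (D ⊕ X)) ⇔ (nLeft X ≡ 0 ⊎ ∃ λ l → T (leftWinsSecond (D ⊕ left X l)))
leftWinsFirst-LeftDeadEnd-⊕ (mk zero _ _ _) (lde _) = mk⇔ (λ _ → inj₁ refl) (λ _ → tt)
leftWinsFirst-LeftDeadEnd-⊕ {D} (mk (suc n) xL _ _) (lde _) =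
  mk⇔ (inj₂ ∘ anyFin⁻ (suc n) moves) [ (λ ()) , (λ (l , w) → anyFin⁺ (suc n) moves l w) ]′
  where
  moves : Fin (suc n) → Bool
  moves l = leftWinsSecond (D ⊕ xL l)

outcomeOf-mono : ∀ {a b c d} → (T c → T a) → (T d → T b) → outcomeOf a b ≥ₒ outcomeOf c d
outcomeOf-mono {true}  {true}  {true}  {true}  _ _ = refl≥
outcomeOf-mono {true}  {true}  {true}  {false} _ _ = 𝓛≥𝓝
outcomeOf-mono {true}  {true}  {false} {true}  _ _ = 𝓛≥𝓟
outcomeOf-mono {true}  {true}  {false} {false} _ _ = 𝓛≥𝓡
outcomeOf-mono {true}  {false} {true}  {false} _ _ = refl≥
outcomeOf-mono {true}  {false} {false} {false} _ _ = 𝓝≥𝓡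
outcomeOf-mono {false} {true}  {false} {true}  _ _ = refl≥
outcomeOf-mono {false} {true}  {false} {false} _ _ = 𝓟≥𝓡
outcomeOf-mono {false} {false} {false} {false} _ _ = refl≥
outcomeOf-mono {_}     {false} {_}     {true}  _ f = ⊥-elim (f tt)
outcomeOf-mono {false} {_}     {true}  {_}     f _ = ⊥-elim (f tt)

outcomeOf-≥ₒ-second : ∀ {a b c d} → outcomeOf a b ≥ₒ outcomeOf c d → T d → T b
outcomeOf-≥ₒ-second {_}     {true}  {_}     {_}    _  _ = tt
outcomeOf-≥ₒ-second {true}  {false} {true}  {true} () _
outcomeOf-≥ₒ-second {true}  {false} {false} {true} () _
outcomeOf-≥ₒ-second {false} {false} {true}  {true} () _
outcomeOf-≥ₒ-second {false} {false} {false} {true} () _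

≼⇒leftWinsFirst : ∀ {B A} → LeftDeadEnd B → LeftDeadEnd A → B ≼ A →
  ∀ X → T (leftWinsFirst (B ⊕ X)) → T (leftWinsFirst (A ⊕ X))
≼⇒leftWinsSecond : ∀ {B A} → LeftDeadEnd B → LeftDeadEnd A → B ≼ A →
  ∀ X → T (leftWinsSecond (B ⊕ X)) → T (leftWinsSecond (A ⊕ X))

≼⇒leftWinsFirst dB dA p X@(mk _ xL _ _) w =
  Equivalence.from (leftWinsFirst-LeftDeadEnd-⊕ X dA)
    (Sum.map₂ (λ (l , wₗ) → l , ≼⇒leftWinsSecond dB dA p (xL l) wₗ)
      (Equivalence.to (leftWinsFirst-LeftDeadEnd-⊕ X dB) w))

≼⇒leftWinsSecond {B} {A} dB@(lde dBʳ) dA@(lde dAʳ) p@(≼-intro end opts) X@(mk _ _ _ xR) w =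
  let (¬end , ws) = leftWinsSecond⁻ (B ⊕ X) w in
  leftWinsSecond⁺ (A ⊕ X) (λ e → let (a , x) = RightEnd-⊕⁻ A X e in ¬end (RightEnd-⊕ B X (end a) x))
    (right-⊕-elim (T ∘ leftWinsFirst) A X
      (λ i → let (j , q) = opts i in
        ≼⇒leftWinsFirst (dBʳ j) (dAʳ i) q X (all-∈ᴿ (T ∘ leftWinsFirst) ws (∈ᴿ-⊕ˡ B X (right∈ᴿ j))))
      (λ x → ≼⇒leftWinsFirst dB dA p (xR x) (all-∈ᴿ (T ∘ leftWinsFirst) ws (∈ᴿ-⊕ʳ B X (right∈ᴿ x)))))

≼⇒≥ₘ : ∀ {B A} → LeftDeadEnd B → LeftDeadEnd A → B ≼ A → A ≥ₘ B
≼⇒≥ₘ dB dA p X = outcomeOf-mono (≼⇒leftWinsFirst dB dA p X) (≼⇒leftWinsSecond dB dA p X)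

integer : ℕ → Game
integer zero    = 𝟘
integer (suc k) = mk 1 (λ _ → integer k) 0 (λ ())

firstRunLength : Game → ℕ
firstRunLength (mk _ _ zero    _) = 0
firstRunLength (mk _ _ (suc _) g) = suc (firstRunLength (g zero))

-- Right keeps taking the first option; Left can only count the integer down, which lasts exactly
-- as long, so Right is the first player without a move.
¬leftWinsSecond-⊕-integer : ∀ {C} → LeftDeadEnd C →
  ¬ T (leftWinsSecond (C ⊕ integer (firstRunLength C)))
¬leftWinsSecond-⊕-integer {mk _ _ zero _} (lde _) ()
¬leftWinsSecond-⊕-integer {C@(mk _ _ (suc _) _)} (lde dCʳ) w =
  let I = integer (firstRunLength C)
      w₀ = all-∈ᴿ (T ∘ leftWinsFirst) (proj₂ (leftWinsSecond⁻ (C ⊕ I) w)) (∈ᴿ-⊕ˡ C I (right∈ᴿ zero))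
  in [ (λ ()) , (λ (_ , w′) → ¬leftWinsSecond-⊕-integer (dCʳ zero) w′) ]′
       (Equivalence.to (leftWinsFirst-LeftDeadEnd-⊕ I (dCʳ zero)) w₀)

Separates : Game → Game → Game → Set
Separates Y B A = T (leftWinsSecond (B ⊕ Y)) × ¬ T (leftWinsSecond (A ⊕ Y))

-- In B ⊕ Y Left answers B^R_j ⊕ Y with the
-- separator Y_j and wins B ⊕ 𝟘 by having no move; in A ⊕ Y Right moves to A^R ⊕ Y, and every Left
-- reply loses.
separate-via-right : ∀ {B A} → LeftDeadEnd B → LeftDeadEnd A →
  ∀ i → (∀ j → ∃ λ Yⱼ → Separates Yⱼ (right B j) (right A i)) → ∃ λ Y → Separates Y B A
separate-via-right {B@(mk _ _ s _)} {A} dB@(lde dBʳ) (lde dAʳ) i sep = Y , B-wins , A-loses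
  where
  Y : Game
  Y = mk (suc s) (integer (firstRunLength (right A i)) ∷ proj₁ ∘ sep) 1 (λ _ → 𝟘)

  B-wins : T (leftWinsSecond (B ⊕ Y))
  B-wins = leftWinsSecond⁺ (B ⊕ Y) (λ e → case m+n≡0⇒n≡0 s e of λ ())
    (right-⊕-elim (T ∘ leftWinsFirst) B Y
      (λ j → Equivalence.from (leftWinsFirst-LeftDeadEnd-⊕ Y (dBʳ j))
               (inj₂ (suc j , proj₁ (proj₂ (sep j)))))
      (λ _ → Equivalence.from (leftWinsFirst-LeftDeadEnd-⊕ 𝟘 dB) (inj₁ refl)))

  A-loses : ¬ T (leftWinsSecond (A ⊕ Y))
  A-loses w =
    [ (λ ()) , (λ { (zero , w′) → ¬leftWinsSecond-⊕-integer (dAʳ i) w′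
                  ; (suc j , w′) → proj₂ (proj₂ (sep j)) w′ }) ]′
      (Equivalence.to (leftWinsFirst-LeftDeadEnd-⊕ Y (dAʳ i))
        (all-∈ᴿ (T ∘ leftWinsFirst) (proj₂ (leftWinsSecond⁻ (A ⊕ Y) w)) (∈ᴿ-⊕ˡ A Y (right∈ᴿ i))))

separate : ∀ {B A} → LeftDeadEnd B → LeftDeadEnd A → ¬ B ≼ A → ∃ λ Y → Separates Y B A
separate {mk _ _ zero _} {mk _ _ zero _} _ _ B⋠A = ⊥-elim (B⋠A (≼-intro (λ _ → refl) (λ ())))
separate {B@(mk _ _ (suc _) _)} {mk _ _ zero _} (lde dBʳ) (lde _) _ =
  𝟘 , leftWinsSecond⁺ (B ⊕ 𝟘) (λ ())
        (right-⊕-elim (T ∘ leftWinsFirst) B 𝟘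
          (λ j → Equivalence.from (leftWinsFirst-LeftDeadEnd-⊕ 𝟘 (dBʳ j)) (inj₁ refl)) (λ ()))
    , λ ()
separate {B@(mk _ _ _ g)} {mk _ _ (suc r) f} dB@(lde dBʳ) dA@(lde dAʳ) B⋠A
  with all? (λ i → any? (λ j → g j ≼? f i))
... | yes below = ⊥-elim (B⋠A (≼-intro (λ ()) below))
... | no ¬below =
  let (i , ¬belowᵢ) = ¬∀⟶∃¬ (suc r) _ (λ i → any? (λ j → g j ≼? f i)) ¬below
  in separate-via-right dB dA i (λ j → separate (dBʳ j) (dAʳ i) (λ p → ¬belowᵢ (j , p)))

≥ₘ⇒≼ : ∀ {B A} → LeftDeadEnd B → LeftDeadEnd A → A ≥ₘ B → B ≼ A
≥ₘ⇒≼ {B} {A} dB dA p = decidable-stable (B ≼? A) λ B⋠A →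
  let (Y , B-wins , A-loses) = separate dB dA B⋠A
  in A-loses (outcomeOf-≥ₒ-second (p Y) B-wins)

mainTheorem3 : (G H : Game) → LeftDeadEnd G → LeftDeadEnd H →
    (n : ℕ) → 0 < n → (n · G) ≡ₘ (n · H) → G ≡ₘ H
mainTheorem3 G H dG dH (suc m) _ (nG≥nH , nH≥nG) =
  let dnG = LeftDeadEnd-· (suc m) dG
      dnH = LeftDeadEnd-· (suc m) dH
      (G≼H , H≼G) = ·-cancel-≋ m (≥ₘ⇒≼ dnG dnH nH≥nG , ≥ₘ⇒≼ dnH dnG nG≥nH)
  in ≼⇒≥ₘ dH dG H≼G , ≼⇒≥ₘ dG dH G≼H
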